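{- Let $q$ be a prime power and let $n,k,d$ be integers with $3\le d\le 4$ and $n\le \frac{q^{n-k}-1}{q-1}-2$. Suppose there exists a linear $[n,k,d]_q2$ code that is quasi-perfect. Then there exists a linear $[n+1,k+1,3]_q2$ code that is quasi-perfect.
   Context: A linear $[n,k,d]_qR$ code is a $k$-dimensional subspace $C$ of $GF(q)^n$ with minimum Hamming distance $d=\min_{c_1\neq c_2\in C} d(c_1,c_2)$ and covering radius $R=\max_{x\in GF(q)^n}\min_{c\in C} d(x,c)$, where $d(\cdot,\cdot)$ is the Hamming distance. The packing radius of $C$ is $e(C)=\lfloor (d-1)/2\rfloor$. A code is called quasi-perfect if, for some nonnegative integer $e$, its packing radius is $e$ and its covering radius is $e+1$. -}

module Defs where

open import Level using (0ℓ)
open import Data.Nat using (ℕ; zero; suc; _+_; _≤_; _∸_; _/_)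
open import Data.Fin using (Fin; zero; suc)
open import Data.Product using (Σ; ∃; _×_; _,_)
open import Data.Bool using (if_then_else_)
open import Relation.Nullary using (¬_; does)
open import Relation.Binary.Definitions using (DecidableEquality)
open import Relation.Binary.PropositionalEquality using (_≡_; _≢_)
open import Algebra.Structures using (IsCommutativeRing)
open import Function.Bundles using (_↔_)

-- A finite field with exactly q elements (q is then necessarily a prime
-- power, and the field is GF(q) up to isomorphism).
record FiniteField (q : ℕ) : Set₁ where
  infixl 6 _⊕_
  infixl 7 _⊛_
  field
    Carrier : Set
    _⊕_ _⊛_ : Carrier → Carrier → Carrier
    ⊖_      : Carrier → Carrier
    0# 1#   : Carrier
    isCommutativeRing : IsCommutativeRing _≡_ _⊕_ _⊛_ ⊖_ 0# 1#
    0≢1     : 0# ≢ 1#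
    inverse : ∀ x → x ≢ 0# → ∃ λ y → x ⊛ y ≡ 1#
    _≟_     : DecidableEquality Carrier
    card    : Carrier ↔ Fin q

module _ {q : ℕ} (F : FiniteField q) where
  open FiniteField F

  Word : ℕ → Set
  Word n = Fin n → Carrier

  sumℕ : ∀ {m} → (Fin m → ℕ) → ℕ
  sumℕ {zero}  f = 0
  sumℕ {suc m} f = f zero + sumℕ (λ i → f (suc i))

  dist : ∀ {n} → Word n → Word n → ℕ
  dist x y = sumℕ (λ j → if does (x j ≟ y j) then 0 else 1)

  lincomb : ∀ {k n} → (Fin k → Carrier) → (Fin k → Word n) → Word n
  lincomb {zero}  c g j = 0#
  lincomb {suc k} c g j = c zero ⊛ g zero j ⊕ lincomb (λ i → c (suc i)) (λ i → g (suc i)) j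

  -- A linear [n,k] code: a k-dimensional subspace of GF(q)^n, given by a
  -- basis (k linearly independent generator words); the code is their span.
  record LinearCode (n k : ℕ) : Set where
    field
      gen   : Fin k → Word n
      indep : ∀ (c : Fin k → Carrier) → (∀ j → lincomb c gen j ≡ 0#) → ∀ i → c i ≡ 0#

  _∈C_ : ∀ {n k} → Word n → LinearCode n k → Set
  x ∈C C = ∃ λ (c : Fin _ → Carrier) → ∀ j → x j ≡ lincomb c (LinearCode.gen C) j

  MinDist : ∀ {n k} → LinearCode n k → ℕ → Set
  MinDist {n} C d =
    (∃ λ (c₁ : Word n) → ∃ λ (c₂ : Word n) →
       c₁ ∈C C × c₂ ∈C C × ¬ (∀ j → c₁ j ≡ c₂ j) × dist c₁ c₂ ≡ d)
    × (∀ (c₁ c₂ : Word n) → c₁ ∈C C → c₂ ∈C C → ¬ (∀ j → c₁ j ≡ c₂ j) → d ≤ dist c₁ c₂)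

  CoveringRadius : ∀ {n k} → LinearCode n k → ℕ → Set
  CoveringRadius {n} C R =
    (∀ (x : Word n) → ∃ λ c → c ∈C C × dist x c ≤ R)
    × (∃ λ (x : Word n) → ∀ c → c ∈C C → R ≤ dist x c)

  PackingRadius : ∀ {n k} → LinearCode n k → ℕ → Set
  PackingRadius C e = ∃ λ d → MinDist C d × e ≡ (d ∸ 1) / 2

  QuasiPerfect : ∀ {n k} → LinearCode n k → Set
  QuasiPerfect C = ∃ λ e → PackingRadius C e × CoveringRadius C (suc e)

  QPCode : (n k d R : ℕ) → Set
  QPCode n k d R = ∃ λ (C : LinearCode n k) → MinDist C d × CoveringRadius C R × QuasiPerfect C

module Submission where

-- Let C be a linear [n,k,d]_q code, d ≥ 3, of covering radius 2, with a deep
-- hole u (every codeword at distance ≥ 2 from u).  Adjoining (1 | u) to the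
-- generators (0 | gᵢ) gives an [n+1,k+1] code C⁺ whose codewords are the words
-- (a | a·u + y), y ∈ C.  Codewords of C⁺ with equal heads differ in the tail by
-- a nonzero codeword of C; with different heads, their tails agree only where u
-- agrees with a codeword of C.  So C⁺ has minimum distance 3, attained by
-- (1 | u) and (0 | c₀) for c₀ nearest to u.  A word (b | x) is within 2 of C⁺
-- since x - b·u is within 2 of C, and (0 | v) is a deep hole of C⁺ for any deep
-- hole v of C outside all cosets a·u + C.  Such a v exists by pigeonhole: the
-- q cosets a·u + C and the words at distance exactly 1 from C number at most
-- q^k·(q + n(q-1)) < q^n, which is what n + 2 ≤ (q^(n-k) - 1)/(q - 1) gives.

open import Defs
open import Data.Nat using (ℕ; zero; suc; _+_; _*_; _∸_; _^_; _≤_; _<_; _/_; _≤?_; NonZero; z≤n; s≤s; >-nonZero⁻¹)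
import Data.Nat.Properties as ℕ
open import Data.Nat.DivMod using (m/n*n≤m; 0/n≡0)
open import Data.Fin using (Fin; zero; suc; combine; remQuot; punchIn; punchOut)
import Data.Fin.Properties as Fin
open import Data.Vec.Functional using (_∷_; head; tail; updateAt)
open import Data.Vec.Functional.Properties using (updateAt-updates; updateAt-minimal)
open import Data.Product using (∃; _×_; _,_; proj₁; proj₂)
open import Data.Product.Function.NonDependent.Propositional using (_×-↔_)
open import Data.Sum using (_⊎_; inj₁; inj₂)
open import Data.Sum.Function.Propositional using (_⊎-↔_)
open import Data.Bool using (if_then_else_)
open import Function using (_∘_)
open import Function.Bundles using (Inverse; _↔_)
open import Function.Properties.Inverse using (↔-refl; ↔-trans)
open import Relation.Nullary using (¬_; does; yes; no; contradiction)
open import Relation.Binary.PropositionalEquality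
  using (_≡_; _≢_; _≗_; refl; sym; trans; cong; cong₂; subst; module ≡-Reasoning)
open import Algebra.Bundles using (CommutativeRing)

-- The counting inequality: with q = q' + 1, the hypothesis of the theorem
-- gives q^k·(q + n·q') < q^n.  (If k > n the hypothesis reads n + 2 ≤ 0.)
counting-bound : ∀ q' n k .{{_ : NonZero q'}} →
  n + 2 ≤ (suc q' ^ (n ∸ k) ∸ 1) / q' →
  suc q' ^ k * (suc q' + n * q') < suc q' ^ n
counting-bound q' n k hyp with k ≤? n
... | no k≰n = contradiction (ℕ.≤-trans (ℕ.m≤n+m 2 n) (subst (n + 2 ≤_) quotient≡0 hyp)) λ ()
  where
  quotient≡0 : (suc q' ^ (n ∸ k) ∸ 1) / q' ≡ 0
  quotient≡0 rewrite ℕ.m≤n⇒m∸n≡0 (ℕ.<⇒≤ (ℕ.≰⇒> k≰n)) = 0/n≡0 q'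
... | yes k≤n = begin-strict
    q ^ k * (q + n * q')  <⟨ ℕ.*-monoʳ-< (q ^ k) {{ℕ.m^n≢0 q k}} cosets<T ⟩
    q ^ k * T             ≡⟨ ℕ.^-distribˡ-+-* q k (n ∸ k) ⟨
    q ^ (k + (n ∸ k))     ≡⟨ cong (q ^_) (ℕ.m+[n∸m]≡n k≤n) ⟩
    q ^ n                 ∎
  where
  open ℕ.≤-Reasoning
  q T : ℕ
  q = suc q'
  T = q ^ (n ∸ k)
  cosets<T : q + n * q' < T
  cosets<T = begin-strict
    q + n * q'           ≤⟨ ℕ.+-monoˡ-≤ (n * q') (ℕ.+-monoˡ-≤ q' (>-nonZero⁻¹ q')) ⟩
    q' + q' + n * q'     ≡⟨ ℕ.+-assoc q' q' (n * q') ⟩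
    (2 + n) * q'         ≡⟨ cong (_* q') (ℕ.+-comm 2 n) ⟩
    (n + 2) * q'         ≤⟨ ℕ.*-monoˡ-≤ q' hyp ⟩
    (T ∸ 1) / q' * q'    ≤⟨ m/n*n≤m (T ∸ 1) q' ⟩
    T ∸ 1                <⟨ ℕ.∸-monoʳ-< (s≤s z≤n) (ℕ.m^n>0 q (n ∸ k)) ⟩
    T                    ∎

module LinearCodes {q : ℕ} (F : FiniteField q) where
  open FiniteField F
  open ≡-Reasoning

  private
    CR : CommutativeRing _ _
    CR = record { isCommutativeRing = isCommutativeRing }
  open CommutativeRing CR using (+-assoc; +-comm; +-identityˡ; +-identityʳ; *-assoc; *-comm;
    *-identityˡ; *-identityʳ; zeroˡ; zeroʳ; distribˡ; -‿inverseʳ; +-group; +-abelianGroup;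
    +-commutativeSemigroup; ring)
  open import Algebra.Properties.Group +-group using (∙-cancelˡ; x∙y⁻¹≈ε⇒x≈y; \\-leftDividesˡ)
  open import Algebra.Properties.AbelianGroup +-abelianGroup using (⁻¹-∙-comm)
  open import Algebra.Properties.CommutativeSemigroup +-commutativeSemigroup using (interchange)
  open import Algebra.Properties.Ring ring using ([y-z]x≈yx-zx)

  zero-multiple : ∀ x y → 0# ⊛ x ⊕ y ≡ y
  zero-multiple x y = trans (cong (_⊕ y) (zeroˡ x)) (+-identityˡ y)

  difference-swap : ∀ p r y₁ y₂ → p ⊕ y₁ ≡ r ⊕ y₂ → p ⊕ ⊖ r ≡ y₂ ⊕ ⊖ y₁
  difference-swap p r y₁ y₂ h = ∙-cancelˡ (y₁ ⊕ r) _ _ (begin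
    y₁ ⊕ r ⊕ (p ⊕ ⊖ r)      ≡⟨ +-assoc y₁ r _ ⟩
    y₁ ⊕ (r ⊕ (p ⊕ ⊖ r))    ≡⟨ cong (λ t → y₁ ⊕ (r ⊕ t)) (+-comm p (⊖ r)) ⟩
    y₁ ⊕ (r ⊕ (⊖ r ⊕ p))    ≡⟨ cong (y₁ ⊕_) (\\-leftDividesˡ r p) ⟩
    y₁ ⊕ p                  ≡⟨ +-comm y₁ p ⟩
    p ⊕ y₁                  ≡⟨ h ⟩
    r ⊕ y₂                  ≡⟨ cong (r ⊕_) (\\-leftDividesˡ y₁ y₂) ⟨
    r ⊕ (y₁ ⊕ (⊖ y₁ ⊕ y₂))  ≡⟨ cong (λ t → r ⊕ (y₁ ⊕ t)) (+-comm (⊖ y₁) y₂) ⟩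
    r ⊕ (y₁ ⊕ (y₂ ⊕ ⊖ y₁))  ≡⟨ +-assoc r y₁ _ ⟨
    r ⊕ y₁ ⊕ (y₂ ⊕ ⊖ y₁)    ≡⟨ cong (_⊕ (y₂ ⊕ ⊖ y₁)) (+-comm r y₁) ⟩
    y₁ ⊕ r ⊕ (y₂ ⊕ ⊖ y₁)    ∎)

  solve-affine : ∀ s a₁ a₂ x y₁ y₂ → s ⊛ (a₁ ⊕ ⊖ a₂) ≡ 1# →
    a₁ ⊛ x ⊕ y₁ ≡ a₂ ⊛ x ⊕ y₂ → x ≡ s ⊛ (y₂ ⊕ ⊖ y₁)
  solve-affine s a₁ a₂ x y₁ y₂ inv h = begin
    x                             ≡⟨ *-identityˡ x ⟨
    1# ⊛ x                        ≡⟨ cong (_⊛ x) inv ⟨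
    s ⊛ (a₁ ⊕ ⊖ a₂) ⊛ x           ≡⟨ *-assoc s _ x ⟩
    s ⊛ ((a₁ ⊕ ⊖ a₂) ⊛ x)         ≡⟨ cong (s ⊛_) ([y-z]x≈yx-zx x a₁ a₂) ⟩
    s ⊛ (a₁ ⊛ x ⊕ ⊖ (a₂ ⊛ x))     ≡⟨ cong (s ⊛_) (difference-swap _ _ y₁ y₂ h) ⟩
    s ⊛ (y₂ ⊕ ⊖ y₁)               ∎

  scaled-difference-+ : ∀ s a₂ a₁ b₂ b₁ →
    s ⊛ (a₂ ⊕ ⊖ a₁) ⊕ s ⊛ (b₂ ⊕ ⊖ b₁) ≡ s ⊛ ((a₂ ⊕ b₂) ⊕ ⊖ (a₁ ⊕ b₁))
  scaled-difference-+ s a₂ a₁ b₂ b₁ = begin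
    s ⊛ (a₂ ⊕ ⊖ a₁) ⊕ s ⊛ (b₂ ⊕ ⊖ b₁)     ≡⟨ distribˡ s _ _ ⟨
    s ⊛ ((a₂ ⊕ ⊖ a₁) ⊕ (b₂ ⊕ ⊖ b₁))       ≡⟨ cong (s ⊛_) (interchange a₂ (⊖ a₁) b₂ (⊖ b₁)) ⟩
    s ⊛ ((a₂ ⊕ b₂) ⊕ (⊖ a₁ ⊕ ⊖ b₁))       ≡⟨ cong (λ t → s ⊛ ((a₂ ⊕ b₂) ⊕ t)) (⁻¹-∙-comm a₁ b₁) ⟩
    s ⊛ ((a₂ ⊕ b₂) ⊕ ⊖ (a₁ ⊕ b₁))         ∎

  left-difference-nonzero : ∀ {x y} → x ≢ y → ⊖ x ⊕ y ≢ 0#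
  left-difference-nonzero {x} {y} x≢y diff≡0 = x≢y (sym (begin
    y                 ≡⟨ \\-leftDividesˡ x y ⟨
    x ⊕ (⊖ x ⊕ y)     ≡⟨ cong (x ⊕_) diff≡0 ⟩
    x ⊕ 0#            ≡⟨ +-identityʳ x ⟩
    x                 ∎))

  lincomb-at : ∀ {k n m} (c : Fin k → Carrier) (g : Fin k → Word F n) (h : Fin k → Word F m) j j' →
    (∀ i → g i j ≡ h i j') → lincomb F c g j ≡ lincomb F c h j'
  lincomb-at {zero}  c g h j j' g≡h = refl
  lincomb-at {suc k} c g h j j' g≡h =
    cong₂ _⊕_ (cong (head c ⊛_) (g≡h zero)) (lincomb-at (tail c) (tail g) (tail h) j j' (g≡h ∘ suc))

  lincomb-coeffs : ∀ {k n} (c c' : Fin k → Carrier) (g : Fin k → Word F n) j →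
    c ≗ c' → lincomb F c g j ≡ lincomb F c' g j
  lincomb-coeffs {zero}  c c' g j c≗c' = refl
  lincomb-coeffs {suc k} c c' g j c≗c' =
    cong₂ _⊕_ (cong (_⊛ g zero j) (c≗c' zero)) (lincomb-coeffs (tail c) (tail c') (tail g) j (c≗c' ∘ suc))

  lincomb-vanishes : ∀ {k n} (c : Fin k → Carrier) (g : Fin k → Word F n) j →
    (∀ i → g i j ≡ 0#) → lincomb F c g j ≡ 0#
  lincomb-vanishes {zero}  c g j g≡0 = refl
  lincomb-vanishes {suc k} c g j g≡0 = begin
    head c ⊛ g zero j ⊕ lincomb F (tail c) (tail g) j
      ≡⟨ cong₂ _⊕_ (cong (head c ⊛_) (g≡0 zero)) (lincomb-vanishes (tail c) (tail g) j (g≡0 ∘ suc)) ⟩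
    head c ⊛ 0# ⊕ 0#  ≡⟨ +-identityʳ _ ⟩
    head c ⊛ 0#       ≡⟨ zeroʳ (head c) ⟩
    0#                ∎

  lincomb-zero : ∀ {k n} (g : Fin k → Word F n) j → lincomb F (λ _ → 0#) g j ≡ 0#
  lincomb-zero {zero}  g j = refl
  lincomb-zero {suc k} g j = trans (zero-multiple (g zero j) _) (lincomb-zero (tail g) j)

  lincomb-scaled-difference : ∀ {k n} s (c₂ c₁ : Fin k → Carrier) (g : Fin k → Word F n) j →
    lincomb F (λ i → s ⊛ (c₂ i ⊕ ⊖ c₁ i)) g j ≡ s ⊛ (lincomb F c₂ g j ⊕ ⊖ lincomb F c₁ g j)
  lincomb-scaled-difference {zero}  s c₂ c₁ g j = sym (trans (cong (s ⊛_) (-‿inverseʳ 0#)) (zeroʳ s))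
  lincomb-scaled-difference {suc k} s c₂ c₁ g j = begin
    s ⊛ (c₂ zero ⊕ ⊖ c₁ zero) ⊛ x ⊕ lincomb F (λ i → s ⊛ (c₂ (suc i) ⊕ ⊖ c₁ (suc i))) (tail g) j
      ≡⟨ cong₂ _⊕_ (*-assoc s _ x) (lincomb-scaled-difference s (tail c₂) (tail c₁) (tail g) j) ⟩
    s ⊛ ((c₂ zero ⊕ ⊖ c₁ zero) ⊛ x) ⊕ s ⊛ (L₂ ⊕ ⊖ L₁)
      ≡⟨ cong (λ t → s ⊛ t ⊕ s ⊛ (L₂ ⊕ ⊖ L₁)) ([y-z]x≈yx-zx x (c₂ zero) (c₁ zero)) ⟩
    s ⊛ (c₂ zero ⊛ x ⊕ ⊖ (c₁ zero ⊛ x)) ⊕ s ⊛ (L₂ ⊕ ⊖ L₁)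
      ≡⟨ scaled-difference-+ s _ _ L₂ L₁ ⟩
    s ⊛ ((c₂ zero ⊛ x ⊕ L₂) ⊕ ⊖ (c₁ zero ⊛ x ⊕ L₁))
      ∎
    where
    x L₁ L₂ : Carrier
    x  = g zero j
    L₁ = lincomb F (tail c₁) (tail g) j
    L₂ = lincomb F (tail c₂) (tail g) j

  zero-∈C : ∀ {n k} (C : LinearCode F n k) → _∈C_ F (λ _ → 0#) C
  zero-∈C C = (λ _ → 0#) , λ j → sym (lincomb-zero (LinearCode.gen C) j)

  ∈C-scaled-difference : ∀ {n k} (C : LinearCode F n k) s {y₁ y₂ : Word F n} →
    _∈C_ F y₁ C → _∈C_ F y₂ C → _∈C_ F (λ j → s ⊛ (y₂ j ⊕ ⊖ y₁ j)) C
  ∈C-scaled-difference C s {y₁} {y₂} (c₁ , y₁≗) (c₂ , y₂≗) = (λ i → s ⊛ (c₂ i ⊕ ⊖ c₁ i)) , λ j → begin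
    s ⊛ (y₂ j ⊕ ⊖ y₁ j)
      ≡⟨ cong₂ (λ a b → s ⊛ (a ⊕ ⊖ b)) (y₂≗ j) (y₁≗ j) ⟩
    s ⊛ (lincomb F c₂ (LinearCode.gen C) j ⊕ ⊖ lincomb F c₁ (LinearCode.gen C) j)
      ≡⟨ lincomb-scaled-difference s c₂ c₁ (LinearCode.gen C) j ⟨
    lincomb F (λ i → s ⊛ (c₂ i ⊕ ⊖ c₁ i)) (LinearCode.gen C) j ∎

  FarFrom : ∀ {n k} → LinearCode F n k → ℕ → Word F n → Set
  FarFrom C r x = ∀ c → _∈C_ F c C → r ≤ dist F x c

  Separated : ∀ {n k} → LinearCode F n k → ℕ → Set
  Separated C d = ∀ c₁ c₂ → _∈C_ F c₁ C → _∈C_ F c₂ C → ¬ (c₁ ≗ c₂) → d ≤ dist F c₁ c₂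

  Covers : ∀ {n k} → LinearCode F n k → ℕ → Set
  Covers C R = ∀ x → ∃ λ c → _∈C_ F c C × dist F x c ≤ R

  dist-same-head : ∀ {n} (x y : Word F (suc n)) → head x ≡ head y → dist F x y ≡ dist F (tail x) (tail y)
  dist-same-head x y x₀≡y₀ with head x ≟ head y
  ... | yes _ = refl
  ... | no x₀≢y₀ = contradiction x₀≡y₀ x₀≢y₀

  dist-different-head : ∀ {n} (x y : Word F (suc n)) → head x ≢ head y →
    dist F x y ≡ suc (dist F (tail x) (tail y))
  dist-different-head x y x₀≢y₀ with head x ≟ head y
  ... | yes x₀≡y₀ = contradiction x₀≡y₀ x₀≢y₀
  ... | no _ = refl

  dist-mono : ∀ {n} (x y x' y' : Word F n) → (∀ j → x j ≡ y j → x' j ≡ y' j) →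
    dist F x' y' ≤ dist F x y
  dist-mono {zero}  x y x' y' agree = z≤n
  dist-mono {suc n} x y x' y' agree =
    ℕ.+-mono-≤ head-mono (dist-mono (tail x) (tail y) (tail x') (tail y') (agree ∘ suc))
    where
    head-mono : (if does (head x' ≟ head y') then 0 else 1) ≤ (if does (head x ≟ head y) then 0 else 1)
    head-mono with head x ≟ head y | head x' ≟ head y'
    ... | _         | yes _       = z≤n
    ... | no _      | no _        = s≤s z≤n
    ... | yes x₀≡y₀ | no x₀'≢y₀'  = contradiction (agree zero x₀≡y₀) x₀'≢y₀'

  dist≡0⇒≗ : ∀ {n} (x y : Word F n) → dist F x y ≡ 0 → x ≗ y
  dist≡0⇒≗ {suc n} x y d≡0 j with head x ≟ head y
  dist≡0⇒≗ {suc n} x y d≡0 zero    | yes x₀≡y₀ = x₀≡y₀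
  dist≡0⇒≗ {suc n} x y d≡0 (suc j) | yes _     = dist≡0⇒≗ (tail x) (tail y) d≡0 j
  dist≡0⇒≗ {suc n} x y () j        | no _

  ≉⇒dist≥1 : ∀ {n} (x y : Word F n) → ¬ (x ≗ y) → 1 ≤ dist F x y
  ≉⇒dist≥1 x y x≉y with dist F x y in eq
  ... | zero  = contradiction (dist≡0⇒≗ x y eq) x≉y
  ... | suc _ = s≤s z≤n

  dist≤1-cases : ∀ {n} (x y : Word F n) → dist F x y ≤ 1 →
    x ≗ y ⊎ ∃ λ j₀ → x j₀ ≢ y j₀ × (∀ j → j ≢ j₀ → x j ≡ y j)
  dist≤1-cases {zero}  x y d≤1 = inj₁ λ ()
  dist≤1-cases {suc n} x y d≤1 with head x ≟ head y
  ... | no x₀≢y₀ = inj₂ (zero , x₀≢y₀ , λ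
    { zero j≢0    → contradiction refl j≢0
    ; (suc j) _   → dist≡0⇒≗ (tail x) (tail y) (ℕ.n≤0⇒n≡0 (ℕ.≤-pred d≤1)) j })
  ... | yes x₀≡y₀ with dist≤1-cases (tail x) (tail y) d≤1
  ...   | inj₁ tails≗ = inj₁ λ { zero → x₀≡y₀ ; (suc j) → tails≗ j }
  ...   | inj₂ (j₀ , differ , agree) = inj₂ (suc j₀ , differ , λ
    { zero _      → x₀≡y₀
    ; (suc j) j≢  → agree j (j≢ ∘ cong suc) })

  single-change : ∀ {n} (x v : Word F n) j₀ → (∀ j → j ≢ j₀ → v j ≡ x j) →
    v ≗ updateAt x j₀ (_⊕ (⊖ x j₀ ⊕ v j₀))
  single-change x v j₀ agree j with j Fin.≟ j₀
  ... | yes refl = sym (trans (updateAt-updates j₀ x) (\\-leftDividesˡ (x j₀) (v j₀)))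
  ... | no j≢j₀  = trans (agree j j≢j₀) (sym (updateAt-minimal j j₀ x j≢j₀))

  OutsideCosets : ∀ {n k} → LinearCode F n k → Word F n → Word F n → Set
  OutsideCosets C u v = ∀ a y → _∈C_ F y C → ¬ (v ≗ λ j → a ⊛ u j ⊕ y j)

  module Extension {n k : ℕ} (C : LinearCode F n k) (u : Word F n) where
    gen : Fin k → Word F n
    gen = LinearCode.gen C

    gen⁺ : Fin (suc k) → Word F (suc n)
    gen⁺ zero    = 1# ∷ u
    gen⁺ (suc i) = 0# ∷ gen i

    lincomb⁺-head : ∀ c → lincomb F c gen⁺ zero ≡ head c
    lincomb⁺-head c = begin
      head c ⊛ 1# ⊕ lincomb F (tail c) (tail gen⁺) zero
        ≡⟨ cong₂ _⊕_ (*-identityʳ (head c)) (lincomb-vanishes (tail c) (tail gen⁺) zero λ _ → refl) ⟩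
      head c ⊕ 0#  ≡⟨ +-identityʳ (head c) ⟩
      head c       ∎

    lincomb⁺-tail : ∀ c j → lincomb F c gen⁺ (suc j) ≡ head c ⊛ u j ⊕ lincomb F (tail c) gen j
    lincomb⁺-tail c j = cong (head c ⊛ u j ⊕_) (lincomb-at (tail c) (tail gen⁺) gen (suc j) j λ _ → refl)

    C⁺ : LinearCode F (suc n) (suc k)
    C⁺ = record { gen = gen⁺ ; indep = independent }
      where
      independent : ∀ c → (∀ j → lincomb F c gen⁺ j ≡ 0#) → ∀ i → c i ≡ 0#
      independent c Σ≡0 zero    = trans (sym (lincomb⁺-head c)) (Σ≡0 zero)
      independent c Σ≡0 (suc i) = LinearCode.indep C (tail c) tail≡0 i
        where
        tail≡0 : ∀ j → lincomb F (tail c) gen j ≡ 0#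
        tail≡0 j = begin
          lincomb F (tail c) gen j               ≡⟨ zero-multiple (u j) _ ⟨
          0# ⊛ u j ⊕ lincomb F (tail c) gen j    ≡⟨ cong (λ a → a ⊛ u j ⊕ lincomb F (tail c) gen j) (independent c Σ≡0 zero) ⟨
          head c ⊛ u j ⊕ lincomb F (tail c) gen j ≡⟨ lincomb⁺-tail c j ⟨
          lincomb F c gen⁺ (suc j)               ≡⟨ Σ≡0 (suc j) ⟩
          0#                                     ∎

    Shape : Word F (suc n) → Carrier → Word F n → Set
    Shape w a y = head w ≡ a × (∀ j → w (suc j) ≡ a ⊛ u j ⊕ y j)

    shape-of-codeword : ∀ {w} → _∈C_ F w C⁺ → ∃ λ a → ∃ λ y → _∈C_ F y C × Shape w a y
    shape-of-codeword (c , w≗) =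
      head c , lincomb F (tail c) gen , (tail c , λ _ → refl) ,
      trans (w≗ zero) (lincomb⁺-head c) , λ j → trans (w≗ (suc j)) (lincomb⁺-tail c j)

    codeword-of-shape : ∀ {w a y} → _∈C_ F y C → Shape w a y → _∈C_ F w C⁺
    codeword-of-shape {w} {a} {y} (e , y≗) (w₀≡a , w≗) = (a ∷ e) , λ
      { zero    → trans w₀≡a (sym (lincomb⁺-head (a ∷ e)))
      ; (suc j) → trans (w≗ j) (trans (cong (a ⊛ u j ⊕_) (y≗ j)) (sym (lincomb⁺-tail (a ∷ e) j))) }

    -- codewords with equal heads differ in the tail by a nonzero codeword of C
    same-head-distance : ∀ {d w₁ w₂ a y₁ y₂} → Separated C d →
      _∈C_ F y₁ C → _∈C_ F y₂ C → Shape w₁ a y₁ → Shape w₂ a y₂ → ¬ (w₁ ≗ w₂) → d ≤ dist F w₁ w₂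
    same-head-distance {d} {w₁} {w₂} {a} {y₁} {y₂} sep y₁∈ y₂∈ (w₁₀ , w₁≗) (w₂₀ , w₂≗) w₁≉w₂ =
      ℕ.≤-trans (sep y₁ y₂ y₁∈ y₂∈ y₁≉y₂)
        (ℕ.≤-trans (dist-mono (tail w₁) (tail w₂) y₁ y₂ tails-agree) (ℕ.m≤n+m _ _))
      where
      tails-agree : ∀ j → w₁ (suc j) ≡ w₂ (suc j) → y₁ j ≡ y₂ j
      tails-agree j w₁≡w₂ = ∙-cancelˡ (a ⊛ u j) _ _ (trans (sym (w₁≗ j)) (trans w₁≡w₂ (w₂≗ j)))
      y₁≉y₂ : ¬ (y₁ ≗ y₂)
      y₁≉y₂ y₁≗y₂ = w₁≉w₂ λ
        { zero    → trans w₁₀ (sym w₂₀)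
        ; (suc j) → trans (w₁≗ j) (trans (cong (a ⊛ u j ⊕_) (y₁≗y₂ j)) (sym (w₂≗ j))) }

    -- codewords with different heads a₁ ≠ a₂ agree in the tail only where u
    -- agrees with the codeword (a₁ - a₂)⁻¹(y₂ - y₁), so they are at distance ≥ 1 + 2
    different-head-distance : ∀ {w₁ w₂ a₁ a₂ y₁ y₂} → FarFrom C 2 u →
      _∈C_ F y₁ C → _∈C_ F y₂ C → Shape w₁ a₁ y₁ → Shape w₂ a₂ y₂ → a₁ ≢ a₂ → 3 ≤ dist F w₁ w₂
    different-head-distance {w₁} {w₂} {a₁} {a₂} {y₁} {y₂} uFar y₁∈ y₂∈ (w₁₀ , w₁≗) (w₂₀ , w₂≗) a₁≢a₂ =
      subst (3 ≤_) (sym (dist-different-head w₁ w₂ heads-differ))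
        (s≤s (ℕ.≤-trans (uFar z z∈) (dist-mono (tail w₁) (tail w₂) u z tails-agree)))
      where
      heads-differ : head w₁ ≢ head w₂
      heads-differ w₁₀≡w₂₀ = a₁≢a₂ (trans (sym w₁₀) (trans w₁₀≡w₂₀ w₂₀))
      a₁-a₂≢0 : a₁ ⊕ ⊖ a₂ ≢ 0#
      a₁-a₂≢0 = a₁≢a₂ ∘ x∙y⁻¹≈ε⇒x≈y a₁ a₂
      s : Carrier
      s = proj₁ (inverse _ a₁-a₂≢0)
      s-inverse : s ⊛ (a₁ ⊕ ⊖ a₂) ≡ 1#
      s-inverse = trans (*-comm s _) (proj₂ (inverse _ a₁-a₂≢0))
      z : Word F n
      z j = s ⊛ (y₂ j ⊕ ⊖ y₁ j)
      z∈ : _∈C_ F z C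
      z∈ = ∈C-scaled-difference C s y₁∈ y₂∈
      tails-agree : ∀ j → w₁ (suc j) ≡ w₂ (suc j) → u j ≡ z j
      tails-agree j w₁≡w₂ = solve-affine s a₁ a₂ (u j) (y₁ j) (y₂ j) s-inverse
        (trans (sym (w₁≗ j)) (trans w₁≡w₂ (w₂≗ j)))

    separated⁺ : ∀ {d} → 3 ≤ d → Separated C d → FarFrom C 2 u → Separated C⁺ 3
    separated⁺ d≥3 sep uFar w₁ w₂ w₁∈ w₂∈ w₁≉w₂
      with shape-of-codeword w₁∈ | shape-of-codeword w₂∈
    ... | a₁ , y₁ , y₁∈ , shape₁ | a₂ , y₂ , y₂∈ , shape₂ with a₁ ≟ a₂
    ...   | yes refl  = ℕ.≤-trans d≥3 (same-head-distance {w₁ = w₁} {w₂ = w₂} sep y₁∈ y₂∈ shape₁ shape₂ w₁≉w₂)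
    ...   | no a₁≢a₂ = different-head-distance {w₁ = w₁} {w₂ = w₂} uFar y₁∈ y₂∈ shape₁ shape₂ a₁≢a₂

    distance-three-pair : ∀ {c₀} → FarFrom C 2 u → _∈C_ F c₀ C → dist F u c₀ ≤ 2 →
      _∈C_ F (1# ∷ u) C⁺ × _∈C_ F (0# ∷ c₀) C⁺ × dist F (1# ∷ u) (0# ∷ c₀) ≡ 3
    distance-three-pair {c₀} uFar c₀∈ u-c₀≤2 =
      codeword-of-shape (zero-∈C C) (refl , λ j → sym (trans (+-identityʳ _) (*-identityˡ (u j)))) ,
      codeword-of-shape c₀∈ (refl , λ j → sym (zero-multiple (u j) (c₀ j))) ,
      trans (dist-different-head (1# ∷ u) (0# ∷ c₀) (0≢1 ∘ sym))
            (cong suc (ℕ.≤-antisym u-c₀≤2 (uFar c₀ c₀∈)))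

    -- (b | x) is within 2 of (b | b·u + c) for c ∈ C nearest to x - b·u
    covers⁺ : Covers C 2 → Covers C⁺ 2
    covers⁺ cov x = w , codeword-of-shape c∈ (refl , λ _ → refl) , dist≤2
      where
      b : Carrier
      b = head x
      y : Word F n
      y j = ⊖ (b ⊛ u j) ⊕ x (suc j)
      c : Word F n
      c = proj₁ (cov y)
      c∈ : _∈C_ F c C
      c∈ = proj₁ (proj₂ (cov y))
      w : Word F (suc n)
      w = b ∷ λ j → b ⊛ u j ⊕ c j
      tails-agree : ∀ j → y j ≡ c j → x (suc j) ≡ w (suc j)
      tails-agree j y≡c = trans (sym (\\-leftDividesˡ (b ⊛ u j) (x (suc j)))) (cong (b ⊛ u j ⊕_) y≡c)
      dist≤2 : dist F x w ≤ 2
      dist≤2 = subst (_≤ 2) (sym (dist-same-head x w refl))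
        (ℕ.≤-trans (dist-mono y c (tail x) (tail w) tails-agree) (proj₂ (proj₂ (cov y))))

    deep-hole⁺ : ∀ {v} → FarFrom C 2 v → OutsideCosets C u v → FarFrom C⁺ 2 (0# ∷ v)
    deep-hole⁺ {v} vFar vOutside w w∈ with shape-of-codeword w∈
    ... | a , y , y∈ , (w₀ , w≗) with a ≟ 0#
    ...   | yes refl = subst (2 ≤_) (sym (dist-same-head (0# ∷ v) w (sym w₀)))
                         (ℕ.≤-trans (vFar y y∈) (dist-mono v (tail w) v y tail-is-y))
      where
      tail-is-y : ∀ j → v j ≡ w (suc j) → v j ≡ y j
      tail-is-y j v≡w = trans v≡w (trans (w≗ j) (zero-multiple (u j) (y j)))
    ...   | no a≢0 = subst (2 ≤_) (sym (dist-different-head (0# ∷ v) w λ 0≡w₀ → a≢0 (trans (sym w₀) (sym 0≡w₀))))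
                       (s≤s (≉⇒dist≥1 v (tail w) λ v≗w → vOutside a y y∈ λ j → trans (v≗w j) (w≗ j)))

    quasi-perfect⁺ : ∀ {d v} → 3 ≤ d → Separated C d → Covers C 2 → FarFrom C 2 u →
      FarFrom C 2 v → OutsideCosets C u v → QPCode F (suc n) (suc k) 3 2
    quasi-perfect⁺ {v = v} d≥3 sep cov uFar vFar vOutside =
      C⁺ , minDist , radius , 1 , (3 , minDist , refl) , radius
      where
      c₀ : Word F n
      c₀ = proj₁ (cov u)
      minDist : MinDist F C⁺ 3
      minDist with distance-three-pair uFar (proj₁ (proj₂ (cov u))) (proj₂ (proj₂ (cov u)))
      ... | w₁∈ , w₂∈ , dist≡3 =
        (1# ∷ u , 0# ∷ c₀ , w₁∈ , w₂∈ , (λ w₁≗w₂ → 0≢1 (sym (w₁≗w₂ zero))) , dist≡3) ,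
        separated⁺ d≥3 sep uFar
      radius : CoveringRadius F C⁺ 2
      radius = covers⁺ cov , 0# ∷ v , deep-hole⁺ vFar vOutside

  -- Enumerating GF(q)^m by Fin (q^m), a word being read as its base-q digits

  toFin : Carrier → Fin q
  toFin = Inverse.to card

  fromFin : Fin q → Carrier
  fromFin = Inverse.from card

  encode : ∀ {m} → Word F m → Fin (q ^ m)
  encode {zero}  w = zero
  encode {suc m} w = combine (toFin (head w)) (encode (tail w))

  decode : ∀ {m} → Fin (q ^ m) → Word F m
  decode {zero}  i = λ ()
  decode {suc m} i = fromFin (proj₁ (remQuot {q} (q ^ m) i)) ∷ decode (proj₂ (remQuot {q} (q ^ m) i))

  encode-cong : ∀ {m} (v w : Word F m) → v ≗ w → encode v ≡ encode w
  encode-cong {zero}  v w v≗w = refl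
  encode-cong {suc m} v w v≗w = cong₂ combine (cong toFin (v≗w zero)) (encode-cong (tail v) (tail w) (v≗w ∘ suc))

  encode-decode : ∀ {m} (i : Fin (q ^ m)) → encode (decode {m} i) ≡ i
  encode-decode {zero}  zero = refl
  encode-decode {suc m} i = begin
    combine (toFin (fromFin r)) (encode (decode {m} s)) ≡⟨ cong₂ combine (Inverse.strictlyInverseˡ card r) (encode-decode {m} s) ⟩
    combine r s                                         ≡⟨ Fin.combine-remQuot {q} (q ^ m) i ⟩
    i                                                   ∎
    where
    r = proj₁ (remQuot {q} (q ^ m) i)
    s = proj₂ (remQuot {q} (q ^ m) i)

  digits : ∀ {m} (w : Word F (suc m)) → remQuot {q} (q ^ m) (encode w) ≡ (toFin (head w) , encode (tail w))
  digits {m} w = Fin.remQuot-combine {q} {q ^ m} (toFin (head w)) (encode (tail w))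

  decode-encode : ∀ {m} (w : Word F m) → decode (encode w) ≗ w
  decode-encode {suc m} w zero =
    trans (cong (fromFin ∘ proj₁) (digits w)) (Inverse.strictlyInverseʳ card (head w))
  decode-encode {suc m} w (suc j) =
    trans (cong (λ digit-rest → decode (proj₂ digit-rest) j) (digits w)) (decode-encode (tail w) j)


  missed-value : ∀ {M N} → M < N → (h : Fin M → Fin N) → ∃ λ y → ∀ p → h p ≢ y
  missed-value {M} {N} M<N h
    with Fin.¬∀⟶∃¬ N (λ y → ∃ λ p → h p ≡ y) (λ y → Fin.any? λ p → h p Fin.≟ y) not-onto
    where
    -- a section of an onto h would inject Fin N into Fin M
    not-onto : ¬ (∀ y → ∃ λ p → h p ≡ y)
    not-onto onto = Fin.<⇒notInjective M<N
      λ {y} {y'} same → trans (sym (proj₂ (onto y))) (trans (cong h same) (proj₂ (onto y')))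
  ... | y , unhit = y , λ p hp≡y → unhit (p , hp≡y)

  unlisted-word : ∀ {n M} {I : Set} → Fin M ↔ I → M < q ^ n → (f : I → Word F n) →
    ∃ λ v → ∀ i → ¬ (v ≗ f i)
  unlisted-word {n} listing M<qⁿ f with missed-value M<qⁿ (encode ∘ f ∘ Inverse.to listing)
  ... | y , unhit = decode y , λ i v≗fi → unhit (Inverse.from listing i) (begin
    encode (f (Inverse.to listing (Inverse.from listing i))) ≡⟨ cong (encode ∘ f) (Inverse.strictlyInverseˡ listing i) ⟩
    encode (f i)                                             ≡⟨ encode-cong (f i) (decode y) (sym ∘ v≗fi) ⟩
    encode (decode {n} y)                                    ≡⟨ encode-decode {n} y ⟩
    y                                                        ∎)

module SecondDeepHole {q' : ℕ} (F : FiniteField (suc q')) where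
  open FiniteField F
  open LinearCodes F

  nonzero : Fin q' → Carrier
  nonzero t = fromFin (punchIn (toFin 0#) t)

  nonzero-onto : ∀ {s} → s ≢ 0# → ∃ λ t → nonzero t ≡ s
  nonzero-onto {s} s≢0 =
    punchOut index≢ , trans (cong fromFin (Fin.punchIn-punchOut index≢)) (Inverse.strictlyInverseʳ card s)
    where
    index≢ : toFin 0# ≢ toFin s
    index≢ same = s≢0 (sym (begin
      0#                   ≡⟨ Inverse.strictlyInverseʳ card 0# ⟨
      fromFin (toFin 0#)   ≡⟨ cong fromFin same ⟩
      fromFin (toFin s)    ≡⟨ Inverse.strictlyInverseʳ card s ⟩
      s                    ∎))
      where open ≡-Reasoning

  -- indices of the words to be avoided: a codeword, together with either a
  -- scalar a (the word a·u + c) or a coordinate and a nonzero scalar (a word at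
  -- distance one from c)
  Index : ℕ → ℕ → Set
  Index n k = Fin (suc q' ^ k) × (Fin (suc q') ⊎ Fin n × Fin q')

  listing : ∀ {n k} → Fin (suc q' ^ k * (suc q' + n * q')) ↔ Index n k
  listing = ↔-trans Fin.*↔× (↔-refl ×-↔ ↔-trans Fin.+↔⊎ (↔-refl ⊎-↔ Fin.*↔×))

  module _ {n k : ℕ} (C : LinearCode F n k) (u : Word F n) where
    gen : Fin k → Word F n
    gen = LinearCode.gen C

    listed : Index n k → Word F n
    listed (e , inj₁ a)        j = fromFin a ⊛ u j ⊕ lincomb F (decode e) gen j
    listed (e , inj₂ (j₀ , t))   = updateAt (lincomb F (decode e) gen) j₀ (_⊕ nonzero t)

    decoded-codeword : ∀ {y} (y∈ : _∈C_ F y C) → lincomb F (decode (encode (proj₁ y∈))) gen ≗ y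
    decoded-codeword (e , y≗) j = trans (lincomb-coeffs _ e gen j (decode-encode e)) (sym (y≗ j))

    -- a word avoiding every listed word is a deep hole outside the cosets a·u + C
    second-deep-hole : suc q' ^ k * (suc q' + n * q') < suc q' ^ n →
      ∃ λ v → FarFrom C 2 v × OutsideCosets C u v
    second-deep-hole bound with unlisted-word (listing {n} {k}) bound listed
    ... | v , unlisted = v , far , outside
      where
      outside : OutsideCosets C u v
      outside a y y∈ v≗ = unlisted (encode (proj₁ y∈) , inj₁ (toFin a)) λ j →
        trans (v≗ j) (sym (cong₂ (λ b c → b ⊛ u j ⊕ c)
          (Inverse.strictlyInverseʳ card a) (decoded-codeword y∈ j)))

      far : FarFrom C 2 v
      far c c∈ with dist F v c ≤? 1
      ... | no d≰1 = ℕ.≰⇒> d≰1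
      ... | yes d≤1 with dist≤1-cases v c d≤1
      ...   | inj₁ v≗c = contradiction (λ j → trans (v≗c j) (sym (zero-multiple (u j) (c j)))) (outside 0# c c∈)
      ...   | inj₂ (j₀ , v≢c , agree) =
                contradiction (λ j → trans (single-change x v j₀ agree-x j) (cong (λ s → updateAt x j₀ (_⊕ s) j) (sym nonzero-t)))
                              (unlisted (encode (proj₁ c∈) , inj₂ (j₀ , t)))
        where
        x : Word F n
        x = lincomb F (decode (encode (proj₁ c∈))) gen
        agree-x : ∀ j → j ≢ j₀ → v j ≡ x j
        agree-x j j≢j₀ = trans (agree j j≢j₀) (sym (decoded-codeword c∈ j))
        difference≢0 : ⊖ x j₀ ⊕ v j₀ ≢ 0#
        difference≢0 = left-difference-nonzero λ x≡v → v≢c (trans (sym x≡v) (decoded-codeword c∈ j₀))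
        t : Fin q'
        t = proj₁ (nonzero-onto difference≢0)
        nonzero-t : nonzero t ≡ ⊖ x j₀ ⊕ v j₀
        nonzero-t = proj₂ (nonzero-onto difference≢0)

theorem2 : (q : ℕ) (F : FiniteField q) (n k d : ℕ) → 3 ≤ d → d ≤ 4 →
    {{_ : NonZero (q ∸ 1)}} →
    n + 2 ≤ (q ^ (n ∸ k) ∸ 1) / (q ∸ 1) →
    QPCode F n k d 2 → QPCode F (suc n) (suc k) 3 2
theorem2 (suc q'@(suc _)) F n k d d≥3 _ bound (C , (_ , separated) , (covers , u , uFar) , _)
  with SecondDeepHole.second-deep-hole F C u (counting-bound q' n k bound)
... | v , vFar , vOutside =
  LinearCodes.Extension.quasi-perfect⁺ F C u d≥3 separated covers uFar vFar vOutside
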